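{- Let $n\in\mathbb{Z}^+$ and let $G$ be a simple graph with $\chi(G)$ finite. Then a proper closed coloring with nonzero remainders mod $n$ of $G$ exists if and only if a (not necessarily proper) closed coloring with nonzero remainders mod $n$ of $G$ exists. In that case, \[ \chi(G)\le \chi_{n}(G) \leq n \, \chi(G). \] More precisely, if $\ell$ is a closed labeling with nonzero remainders mod $n$ of $G$, then \[ \chi(G) \le \chi_{n}(G) \leq |\ell| \, \chi(G).\]
   Context: Graphs are simple (possibly infinite) graphs $G=(V,E)$. A $\mathbb{Z}$-labeling (coloring) of $G$ is a map $\ell:V\to\mathbb{Z}$; its order $|\ell|$ is the size of its range. It is proper if adjacent vertices get different labels; $\chi(G)$ is the minimum order of a proper labeling. $N[v]$ denotes the closed neighborhood of $v$ ($v$ together with its neighbors). For $n\in\mathbb{Z}^+$, a closed coloring with nonzero remainders mod $n$ is a labeling $\ell$ with $\sum_{w\in N[v]}\ell(w)\not\equiv 0 \pmod n$ for every $v\in V$. If no proper such coloring exists, $\chi_n(G)$ does not exist; if proper such colorings of finite order exist, $\chi_n(G)$ is the minimum order of a proper closed coloring with nonzero remainders mod $n$; if they exist only of infinite order, $\chi_n(G)=\infty$. -}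

module Defs where

open import Level using (Level; suc; _⊔_)
open import Data.Nat using (ℕ)
open import Data.Fin using (Fin)
open import Data.Integer using (ℤ; +_; _+_; 0ℤ)
open import Data.Integer.Divisibility using (_∣_)
open import Data.List using (List; foldr; map; _∷_)
open import Data.List.Membership.Propositional using (_∈_; _∉_)
open import Data.List.Relation.Unary.Unique.Propositional using (Unique)
open import Data.Product using (Σ; ∃; _×_; _,_)
open import Relation.Binary.PropositionalEquality using (_≡_; _≢_)
open import Relation.Nullary using (¬_)

-- A simple, locally finite (possibly infinite) graph: the vertex set is an
-- arbitrary type V, and each vertex has a finite, duplicate-free list of
-- neighbours; adjacency is symmetric and irreflexive (no loops).
record Graph (a : Level) : Set (suc a) where
  field
    V     : Set a
    nbrs  : V → List V
    nbrs-unique : ∀ v → Unique (nbrs v)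
    irrefl : ∀ v → v ∉ nbrs v
    sym    : ∀ v w → w ∈ nbrs v → v ∈ nbrs w

  Adj : V → V → Set a
  Adj v w = w ∈ nbrs v

  closedNbhd : V → List V
  closedNbhd v = v ∷ nbrs v

open Graph public

module _ {a : Level} (G : Graph a) where

  Labeling : Set a
  Labeling = V G → ℤ

  Proper : Labeling → Set a
  Proper ℓ = ∀ v w → Adj G v w → ℓ v ≢ ℓ w

  closedSum : Labeling → V G → ℤ
  closedSum ℓ v = foldr _+_ 0ℤ (map ℓ (closedNbhd G v))

  ClosedNZ : ℕ → Labeling → Set a
  ClosedNZ n ℓ = ∀ v → ¬ (+ n ∣ closedSum ℓ v)

  -- |ℓ| ≤ k : the range of ℓ is covered by k integers
  -- (so |ℓ| is finite iff OrderAtMost ℓ k for some k, and then |ℓ| is the least such k)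
  OrderAtMost : Labeling → ℕ → Set a
  OrderAtMost ℓ k = Σ (Fin k → ℤ) λ f → ∀ v → ∃ λ i → ℓ v ≡ f i

  ChromaticNumber : ℕ → Set a
  ChromaticNumber c =
    (Σ Labeling λ ℓ → Proper ℓ × OrderAtMost ℓ c) ×
    (∀ ℓ k → Proper ℓ → OrderAtMost ℓ k → c Data.Nat.≤ k)

{-# OPTIONS --safe #-}
-- Fix a proper colouring κ : V → Fin χ(G) and a closed labelling ℓ with nonzero
-- remainders mod n. The labelling v ↦ n·κ(v) + (ℓ(v) mod n) is congruent to ℓ mod n at
-- every vertex, hence so are its closed sums, and it keeps nonzero remainders. It is
-- proper because κ(v) is its quotient by n. Its value is a function of the pair
-- (ℓ(v) mod n, κ(v)), and also of the pair (ℓ(v), κ(v)), so its order is at most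
-- n·χ(G) and at most |ℓ|·χ(G). The lower bound χ(G) ≤ χₙ(G) is the minimality of χ(G).
module Submission where

open import Defs
open import Level using (Level)
open import Data.Nat using (ℕ; _≤_; _*_; NonZero; >-nonZero)
import Data.Nat as ℕ
open import Data.Fin using (Fin; toℕ; fromℕ<; combine; remQuot)
open import Data.Fin.Properties using (toℕ-injective; toℕ-fromℕ<; toℕ-combine; combine-injectiveˡ; remQuot-combine)
open import Data.Integer using (ℤ; +_; _+_; _-_; 0ℤ)
import Data.Integer as ℤ
open import Data.Integer.Properties using (pos-+; pos-*; +-injective)
open import Data.Integer.DivMod using (_%ℕ_; _/ℕ_; n%ℕd<d; a≡a%ℕn+[a/ℕn]*n)
open import Data.Integer.Divisibility.Signed using (divides; ∣m∣n⇒∣m+n; ∣m∣n⇒∣m-n; ∣ᵤ⇒∣; ∣⇒∣ᵤ)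
  renaming (_∣_ to _∣ₛ_)
open import Data.Integer.Solver using (module +-*-Solver)
open import Data.List using ([]; _∷_; foldr; map)
open import Data.Product using (Σ; _×_; _,_; proj₁; proj₂; uncurry)
open import Function.Base using (_∘_)
open import Function.Bundles using (_⇔_; mk⇔)
open import Relation.Binary.PropositionalEquality using (_≡_; _≢_; refl; trans; cong; cong₂; subst; module ≡-Reasoning)
  renaming (sym to ≡-sym)

open +-*-Solver using (solve; _:+_; _:-_; _:*_; _:=_)

infix 4 _≡_[mod_]
record _≡_[mod_] (x y : ℤ) (n : ℕ) : Set where
  constructor congruent
  field n∣difference : + n ∣ₛ (x - y)

+-cong-mod : ∀ {n x x′ y y′} → x′ ≡ x [mod n ] → y′ ≡ y [mod n ] → x′ + y′ ≡ x + y [mod n ]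
+-cong-mod {n} {x} {x′} {y} {y′} (congruent n∣x′-x) (congruent n∣y′-y) =
  congruent (subst (+ n ∣ₛ_) (≡-sym (interchange x′ y′ x y)) (∣m∣n⇒∣m+n n∣x′-x n∣y′-y))
  where
  interchange : ∀ a b c d → (a + b) - (c + d) ≡ (a - c) + (b - d)
  interchange = solve 4 (λ a b c d → (a :+ b) :- (c :+ d) := (a :- c) :+ (b :- d)) refl

∣-resp-≡mod : ∀ {n x y} → x ≡ y [mod n ] → + n ∣ₛ x → + n ∣ₛ y
∣-resp-≡mod {n} {x} {y} (congruent n∣x-y) n∣x = subst (+ n ∣ₛ_) (cancel x y) (∣m∣n⇒∣m-n n∣x n∣x-y)
  where
  cancel : ∀ a b → a - (a - b) ≡ b
  cancel = solve 2 (λ a b → a :- (a :- b) := b) refl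

sum-cong-mod : ∀ {a} {A : Set a} {n} (f g : A → ℤ) → (∀ x → f x ≡ g x [mod n ]) →
               ∀ xs → foldr _+_ 0ℤ (map f xs) ≡ foldr _+_ 0ℤ (map g xs) [mod n ]
sum-cong-mod f g f≡g []       = congruent (divides 0ℤ refl)
sum-cong-mod f g f≡g (x ∷ xs) = +-cong-mod (f≡g x) (sum-cong-mod f g f≡g xs)

n*j+x%ℕn≡x : ∀ n j x .{{_ : NonZero n}} → + (n * j ℕ.+ x %ℕ n) ≡ x [mod n ]
n*j+x%ℕn≡x n j x = congruent (divides (+ j - x /ℕ n) (begin
  + (n * j ℕ.+ r) - x                          ≡⟨ cong₂ _-_ n*j+r-as-ℤ (a≡a%ℕn+[a/ℕn]*n x n) ⟩
  (+ n ℤ.* + j + + r) - (+ r + x /ℕ n ℤ.* + n) ≡⟨ rearrange (+ n) (+ j) (+ r) (x /ℕ n) ⟩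
  (+ j - x /ℕ n) ℤ.* + n                       ∎))
  where
  open ≡-Reasoning
  r : ℕ
  r = x %ℕ n
  n*j+r-as-ℤ : + (n * j ℕ.+ r) ≡ + n ℤ.* + j + + r
  n*j+r-as-ℤ = trans (pos-+ (n * j) r) (cong (_+ + r) (pos-* n j))
  rearrange : ∀ a b c d → (a ℤ.* b + c) - (c + d ℤ.* a) ≡ (b - d) ℤ.* a
  rearrange = solve 4 (λ a b c d → (a :* b :+ c) :- (c :+ d :* a) := (b :- d) :* a) refl

module _ {a : Level} (G : Graph a) where

  ClosedNZ-cong-mod : ∀ {n} (ℓ ℓ′ : Labeling G) → (∀ v → ℓ′ v ≡ ℓ v [mod n ]) →
                      ClosedNZ G n ℓ → ClosedNZ G n ℓ′
  ClosedNZ-cong-mod ℓ ℓ′ ℓ′≡ℓ nz v n∣Σℓ′ =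
    nz v (∣⇒∣ᵤ (∣-resp-≡mod (sum-cong-mod ℓ′ ℓ ℓ′≡ℓ (closedNbhd G v)) (∣ᵤ⇒∣ n∣Σℓ′)))

  OrderAtMost-factor : ∀ {m k} (ℓ : Labeling G) (α : V G → Fin m) (β : V G → Fin k)
                       (φ : Fin m → Fin k → ℤ) → (∀ v → ℓ v ≡ φ (α v) (β v)) →
                       OrderAtMost G ℓ (m * k)
  OrderAtMost-factor {m} {k} ℓ α β φ ℓ≡φ =
    (λ i → uncurry φ (remQuot {m} k i)) ,
    λ v → combine (α v) (β v) ,
          trans (ℓ≡φ v) (cong (uncurry φ) (≡-sym (remQuot-combine (α v) (β v))))

  ProperClosedNZ : ℕ → ℕ → Set a
  ProperClosedNZ n k = Σ (Labeling G) λ ℓ′ → Proper G ℓ′ × ClosedNZ G n ℓ′ × OrderAtMost G ℓ′ k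

  colourIndex-proper : ∀ {c} (ℓ : Labeling G) ((_ , ℓ∈range) : OrderAtMost G ℓ c) → Proper G ℓ →
                       ∀ v w → Adj G v w → proj₁ (ℓ∈range v) ≢ proj₁ (ℓ∈range w)
  colourIndex-proper ℓ (f , ℓ∈range) ℓ-proper v w adj i≡j = ℓ-proper v w adj (begin
    ℓ v                        ≡⟨ proj₂ (ℓ∈range v) ⟩
    f (proj₁ (ℓ∈range v))      ≡⟨ cong f i≡j ⟩
    f (proj₁ (ℓ∈range w))      ≡⟨ ≡-sym (proj₂ (ℓ∈range w)) ⟩
    ℓ w                        ∎)
    where open ≡-Reasoning

  module Refinement (n : ℕ) .{{_ : NonZero n}} {c : ℕ} (κ : V G → Fin c)
                    (κ-proper : ∀ v w → Adj G v w → κ v ≢ κ w) where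

    residue : ℤ → Fin n
    residue x = fromℕ< (n%ℕd<d x n)

    encode : Fin n → Fin c → ℤ
    encode r j = + toℕ (combine j r)

    refine : Labeling G → Labeling G
    refine ℓ v = encode (residue (ℓ v)) (κ v)

    refine-≡mod : ∀ ℓ v → refine ℓ v ≡ ℓ v [mod n ]
    refine-≡mod ℓ v = subst (_≡ ℓ v [mod n ]) (cong +_ (≡-sym (begin
      toℕ (combine (κ v) (residue (ℓ v)))     ≡⟨ toℕ-combine (κ v) (residue (ℓ v)) ⟩
      n * toℕ (κ v) ℕ.+ toℕ (residue (ℓ v))   ≡⟨ cong (n * toℕ (κ v) ℕ.+_) (toℕ-fromℕ< (n%ℕd<d (ℓ v) n)) ⟩
      n * toℕ (κ v) ℕ.+ ℓ v %ℕ n              ∎)))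
      (n*j+x%ℕn≡x n (toℕ (κ v)) (ℓ v))
      where open ≡-Reasoning

    refine-proper : ∀ ℓ → Proper G (refine ℓ)
    refine-proper ℓ v w adj eq =
      κ-proper v w adj (combine-injectiveˡ (κ v) _ (κ w) _ (toℕ-injective (+-injective eq)))

    refine-ProperClosedNZ : ∀ {m} ℓ → ClosedNZ G n ℓ → OrderAtMost G (refine ℓ) m → ProperClosedNZ n m
    refine-ProperClosedNZ ℓ nz order =
      refine ℓ , refine-proper ℓ , ClosedNZ-cong-mod ℓ (refine ℓ) (refine-≡mod ℓ) nz , order

    refine-order-n* : ∀ ℓ → OrderAtMost G (refine ℓ) (n * c)
    refine-order-n* ℓ = OrderAtMost-factor (refine ℓ) (residue ∘ ℓ) κ encode (λ _ → refl)

    refine-order-|ℓ|* : ∀ ℓ m → OrderAtMost G ℓ m → OrderAtMost G (refine ℓ) (m * c)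
    refine-order-|ℓ|* ℓ m (f , ℓ∈range) =
      OrderAtMost-factor (refine ℓ) (λ v → proj₁ (ℓ∈range v)) κ (λ i → encode (residue (f i)))
        (λ v → cong (λ x → encode (residue x) (κ v)) (proj₂ (ℓ∈range v)))

theorem3p3 : {a : Level} (G : Graph a) (n c : ℕ) → 1 ≤ n → ChromaticNumber G c →
    ((Σ (Labeling G) λ ℓ → Proper G ℓ × ClosedNZ G n ℓ) ⇔ (Σ (Labeling G) λ ℓ → ClosedNZ G n ℓ))
    × (∀ ℓ → ClosedNZ G n ℓ →
        -- χ(G) ≤ χ_n(G): every proper closed coloring has order ≥ χ(G)
        (∀ ℓ′ k → Proper G ℓ′ → ClosedNZ G n ℓ′ → OrderAtMost G ℓ′ k → c ≤ k)
        -- χ_n(G) ≤ n χ(G)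
        × (Σ (Labeling G) λ ℓ′ → Proper G ℓ′ × ClosedNZ G n ℓ′ × OrderAtMost G ℓ′ (n * c))
        -- χ_n(G) ≤ |ℓ| χ(G)
        × (∀ m → OrderAtMost G ℓ m →
             Σ (Labeling G) λ ℓ′ → Proper G ℓ′ × ClosedNZ G n ℓ′ × OrderAtMost G ℓ′ (m * c)))
theorem3p3 G n c 1≤n ((χ-colouring , χ-proper , χ-order) , χ-minimal) =
  mk⇔ (λ (ℓ , _ , nz) → ℓ , nz) (λ (ℓ , nz) → forgetOrder (bound-n* ℓ nz)) ,
  λ ℓ nz → (λ ℓ′ k ℓ′-proper _ → χ-minimal ℓ′ k ℓ′-proper) ,
           bound-n* ℓ nz ,
           (λ m order → refine-ProperClosedNZ ℓ nz (refine-order-|ℓ|* ℓ m order))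
  where
  instance
    n-nonZero : NonZero n
    n-nonZero = >-nonZero 1≤n
  open Refinement G n (λ v → proj₁ (proj₂ χ-order v)) (colourIndex-proper G χ-colouring χ-order χ-proper)

  bound-n* : ∀ ℓ → ClosedNZ G n ℓ → ProperClosedNZ G n (n * c)
  bound-n* ℓ nz = refine-ProperClosedNZ ℓ nz (refine-order-n* ℓ)

  forgetOrder : ProperClosedNZ G n (n * c) → Σ (Labeling G) λ ℓ → Proper G ℓ × ClosedNZ G n ℓ
  forgetOrder (ℓ , proper , nz , _) = ℓ , proper , nz
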